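{- Let $G$ be a graph with domination number $\gamma$. For any integer $k\ge 2$ and any $\alpha_1,\dots,\alpha_k\in(0,1)$ with $\alpha_1+\alpha_2+\cdots+\alpha_k\le 1$, $$\mathrm{pd}_{\alpha_1}(G)+\mathrm{pd}_{\alpha_2}(G)+\cdots+\mathrm{pd}_{\alpha_k}(G)\le \frac{k}{2}(\gamma+1).$$
   Context: All graphs are finite and simple. For a graph $G=(V,E)$ and $S\subseteq V$, $N[S]$ denotes the closed neighbourhood of $S$. For $0<\alpha\le 1$, a set $S\subseteq V$ is an $\alpha$-partial dominating set if $|N[S]|\ge \alpha|V|$; $\mathrm{pd}_\alpha(G)$ is the minimum size of an $\alpha$-partial dominating set. $\gamma$ denotes the domination number.
   Formalization: The parameters $\alpha_1,\dots,\alpha_k$ are rational numbers in $(0,1)$. -}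

module Defs where

open import Data.Nat using (ℕ; zero; suc; _+_; _≤_)
open import Data.Bool using (Bool; true; false; _∨_; _∧_)
open import Data.Fin using (Fin)
import Data.Fin as F
open import Data.Fin.Subset using (Subset; ∣_∣)
open import Data.Vec using (Vec; tabulate; lookup)
open import Data.Integer using (+_)
open import Data.Rational using (ℚ; _/_; 0ℚ)
import Data.Rational as Q
open import Data.Product using (Σ; _×_)
open import Relation.Binary.PropositionalEquality using (_≡_)
open import Relation.Nullary using (¬_)

record Graph (n : ℕ) : Set where
  field
    adj   : Fin n → Fin n → Bool
    sym   : ∀ u v → adj u v ≡ adj v u
    irrefl : ∀ v → adj v v ≡ false
open Graph public

anyFin : ∀ {n} → (Fin n → Bool) → Bool
anyFin {zero}  f = false
anyFin {suc n} f = f F.zero ∨ anyFin (λ i → f (F.suc i))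

closedNbhd : ∀ {n} → Graph n → Subset n → Subset n
closedNbhd G S = tabulate λ v → lookup S v ∨ anyFin (λ u → lookup S u ∧ adj G u v)

toℚ : ℕ → ℚ
toℚ m = (+ m) / 1

IsPartialDom : ∀ {n} → Graph n → ℚ → Subset n → Set
IsPartialDom {n} G α S = α Q.* toℚ n Q.≤ toℚ ∣ closedNbhd G S ∣

IsDom : ∀ {n} → Graph n → Subset n → Set
IsDom {n} G S = ∣ closedNbhd G S ∣ ≡ n

IsPd : ∀ {n} → Graph n → ℚ → ℕ → Set
IsPd G α p =
  Σ (Subset _) (λ S → IsPartialDom G α S × ∣ S ∣ ≡ p)
  × (∀ S → IsPartialDom G α S → p ≤ ∣ S ∣)

IsDomNum : ∀ {n} → Graph n → ℕ → Set
IsDomNum G g =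
  Σ (Subset _) (λ S → IsDom G S × ∣ S ∣ ≡ g)
  × (∀ S → IsDom G S → g ≤ ∣ S ∣)

sumℕ : ∀ {k} → (Fin k → ℕ) → ℕ
sumℕ {zero}  f = 0
sumℕ {suc k} f = f F.zero + sumℕ (λ i → f (F.suc i))

sumℚ : ∀ {k} → (Fin k → ℚ) → ℚ
sumℚ {zero}  f = 0ℚ
sumℚ {suc k} f = f F.zero Q.+ sumℚ (λ i → f (F.suc i))

{-# OPTIONS --safe #-}

-- Let D be a minimum dominating set and cut it, in vertex order, into a prefix A
-- and a suffix B. Since N[A] ∪ N[B] = V, at the first cut where N[A] reaches α|V|
-- the previous prefix fell short, so the matching suffix dominates more than
-- (1 - α)|V| ≥ β|V| vertices; this gives pd_α + pd_β ≤ γ + 1 whenever α + β ≤ 1.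
-- Any two of the α_i sum to at most 1, and adding the bound over the k cyclically
-- consecutive pairs counts every pd_{α_i} twice.

module Submission where

open import Defs
open import Data.Nat using (ℕ; zero; suc; _+_; _*_; _≤_)
open import Data.Fin using (Fin)
open import Data.Rational using (ℚ; 0ℚ; 1ℚ; _<_) renaming (_≤_ to _≤ℚ_)

open import Algebra.Bundles using (CommutativeMonoid)
open import Algebra.Properties.CommutativeSemigroup using (interchange)
open import Data.Bool using (Bool; true; _∨_; _∧_)
import Data.Bool.Properties as Bool
open import Data.Fin.Subset using (Subset; ∣_∣; ⊥; ⊤; _∩_; _∪_; _─_; inside; outside)
open import Data.Fin.Subset.Properties using (∣p∣≤∣x∷p∣; ∩-identityʳ; p─⊥≡p)
import Data.Integer as ℤ
import Data.Integer.Properties as ℤ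
import Data.Nat as ℕ
import Data.Nat.Coprimality as Coprime
import Data.Nat.Properties as ℕ
open import Data.Empty using (⊥-elim)
open import Data.Nat.Solver using (module +-*-Solver)
open import Data.Product using (_×_; _,_; ∃-syntax)
open import Data.Rational as ℚ using (mkℚ; *≤*; toℚᵘ)
import Data.Rational.Properties as ℚ
import Data.Rational.Unnormalised as ℚᵘ
import Data.Rational.Unnormalised.Properties as ℚᵘ
open import Data.Sum using (_⊎_; inj₁; inj₂; [_,_]′)
open import Data.Vec using (Vec; []; _∷_; lookup)
import Data.Vec.Properties as Vec
import Data.Fin as Fin
import Data.Fin.Properties as Fin
open import Function using (_∘_)
open import Relation.Binary.PropositionalEquality as ≡ using (_≡_; _≢_; refl; cong; cong₂; subst; module ≡-Reasoning)
open import Relation.Nullary using (¬_; yes; no)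
open import Relation.Unary using (Decidable)

toℚ≡mkℚ : ∀ m → toℚ m ≡ mkℚ (ℤ.+ m) 0 (Coprime.sym (Coprime.1-coprimeTo m))
toℚ≡mkℚ m = ℚ.normalize-coprime (Coprime.sym (Coprime.1-coprimeTo m))

toℚ-+ : ∀ a b → toℚ (a + b) ≡ toℚ a ℚ.+ toℚ b
toℚ-+ a b = ℚ.toℚᵘ-injective (ℚᵘ.≃-trans eq (ℚᵘ.≃-sym (ℚ.toℚᵘ-homo-+ (toℚ a) (toℚ b))))
  where
  open ≡-Reasoning
  eq : toℚᵘ (toℚ (a + b)) ℚᵘ.≃ toℚᵘ (toℚ a) ℚᵘ.+ toℚᵘ (toℚ b)
  eq rewrite toℚ≡mkℚ (a + b) | toℚ≡mkℚ a | toℚ≡mkℚ b = ℚᵘ.*≡* (cong (ℤ._* ℤ.+ 1) (begin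
    ℤ.+ (a + b)                      ≡⟨ ℤ.pos-+ a b ⟩
    ℤ.+ a ℤ.+ ℤ.+ b                  ≡⟨ cong₂ ℤ._+_ (ℤ.*-identityʳ (ℤ.+ a)) (ℤ.*-identityʳ (ℤ.+ b)) ⟨
    ℤ.+ a ℤ.* ℤ.+ 1 ℤ.+ ℤ.+ b ℤ.* ℤ.+ 1  ∎))

toℚ-mono-≤ : ∀ {a b} → a ≤ b → toℚ a ≤ℚ toℚ b
toℚ-mono-≤ {a} {b} a≤b rewrite toℚ≡mkℚ a | toℚ≡mkℚ b = *≤* (ℤ.*-monoʳ-≤-nonNeg (ℤ.+ 1) (ℤ.+≤+ a≤b))

*toℚ≤toℚ : ∀ {α} m → α ≤ℚ 1ℚ → α ℚ.* toℚ m ≤ℚ toℚ m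
*toℚ≤toℚ {α} m α≤1 = ℚ.≤-trans (ℚ.*-monoʳ-≤-nonNeg (toℚ m) {{ℚ.normalize-nonNeg m 1}} α≤1)
                                (ℚ.≤-reflexive (ℚ.*-identityˡ (toℚ m)))

x+y≤u+v⇒u<x⇒y≤v : ∀ {x y u v} → x ℚ.+ y ≤ℚ u ℚ.+ v → u < x → y ≤ℚ v
x+y≤u+v⇒u<x⇒y≤v x+y≤u+v u<x = ℚ.≮⇒≥ λ v<y → ℚ.<-irrefl refl (ℚ.<-≤-trans (ℚ.+-mono-< u<x v<y) x+y≤u+v)

sumℚ-nonNeg : ∀ {k} {α : Fin k → ℚ} → (∀ i → 0ℚ ≤ℚ α i) → 0ℚ ≤ℚ sumℚ α
sumℚ-nonNeg {zero}  α≥0 = ℚ.≤-refl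
sumℚ-nonNeg {suc k} α≥0 = ℚ.+-mono-≤ (α≥0 Fin.zero) (sumℚ-nonNeg (α≥0 ∘ Fin.suc))

x≤x+y : ∀ {x y} → 0ℚ ≤ℚ y → x ≤ℚ x ℚ.+ y
x≤x+y {x} {y} y≥0 = ℚ.≤-trans (ℚ.≤-reflexive (≡.sym (ℚ.+-identityʳ x))) (ℚ.+-monoʳ-≤ x y≥0)

x≤y⇒x≤z+y : ∀ {x y z} → 0ℚ ≤ℚ z → x ≤ℚ y → x ≤ℚ z ℚ.+ y
x≤y⇒x≤z+y {x} {y} {z} z≥0 x≤y = ℚ.≤-trans (ℚ.≤-reflexive (≡.sym (ℚ.+-identityˡ x))) (ℚ.+-mono-≤ z≥0 x≤y)

term≤sumℚ : ∀ {k} (α : Fin k → ℚ) → (∀ i → 0ℚ ≤ℚ α i) → ∀ i → α i ≤ℚ sumℚ α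
term≤sumℚ α α≥0 Fin.zero    = x≤x+y (sumℚ-nonNeg (α≥0 ∘ Fin.suc))
term≤sumℚ α α≥0 (Fin.suc i) = x≤y⇒x≤z+y (α≥0 Fin.zero) (term≤sumℚ (α ∘ Fin.suc) (α≥0 ∘ Fin.suc) i)

two-terms≤sumℚ : ∀ {k} (α : Fin k → ℚ) → (∀ i → 0ℚ ≤ℚ α i) →
                 ∀ {i j} → i ≢ j → α i ℚ.+ α j ≤ℚ sumℚ α
two-terms≤sumℚ α α≥0 {Fin.zero}  {Fin.zero}  0≢0 = ⊥-elim (0≢0 refl)
two-terms≤sumℚ α α≥0 {Fin.zero}  {Fin.suc j} _   =
  ℚ.+-monoʳ-≤ (α Fin.zero) (term≤sumℚ (α ∘ Fin.suc) (α≥0 ∘ Fin.suc) j)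
two-terms≤sumℚ α α≥0 {Fin.suc i} {Fin.zero}  _   =
  ℚ.≤-trans (ℚ.≤-reflexive (ℚ.+-comm (α (Fin.suc i)) (α Fin.zero)))
            (ℚ.+-monoʳ-≤ (α Fin.zero) (term≤sumℚ (α ∘ Fin.suc) (α≥0 ∘ Fin.suc) i))
two-terms≤sumℚ α α≥0 {Fin.suc i} {Fin.suc j} i≢j =
  x≤y⇒x≤z+y (α≥0 Fin.zero) (two-terms≤sumℚ (α ∘ Fin.suc) (α≥0 ∘ Fin.suc) (i≢j ∘ cong Fin.suc))

2*sumℕ≤ : ∀ {m} (f : Fin (suc m) → ℕ) {c} → (∀ {i j} → i ≢ j → f i + f j ≤ c) →
          2 * sumℕ f ≤ m * c + (f Fin.zero + f (Fin.fromℕ m))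
2*sumℕ≤ {zero}  f _ = ℕ.≤-reflexive (solve 1 (λ a → con 2 :* (a :+ con 0) := a :+ a) refl (f Fin.zero))
  where open +-*-Solver
2*sumℕ≤ {suc m} f {c} bound = begin
  2 * (f₀ + sumℕ (f ∘ Fin.suc))           ≡⟨ ℕ.*-distribˡ-+ 2 f₀ _ ⟩
  2 * f₀ + 2 * sumℕ (f ∘ Fin.suc)         ≤⟨ ℕ.+-monoʳ-≤ (2 * f₀) (2*sumℕ≤ (f ∘ Fin.suc) bound′) ⟩
  2 * f₀ + (m * c + (f₁ + fₗ))            ≡⟨ rearrange ⟩
  (f₀ + f₁) + m * c + (f₀ + fₗ)           ≤⟨ ℕ.+-monoˡ-≤ (f₀ + fₗ) (ℕ.+-monoˡ-≤ (m * c) (bound λ ())) ⟩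
  c + m * c + (f₀ + fₗ)                   ∎
  where
  open ℕ.≤-Reasoning
  f₀ = f Fin.zero
  f₁ = f (Fin.suc Fin.zero)
  fₗ = f (Fin.fromℕ (suc m))
  bound′ : ∀ {i j} → i ≢ j → f (Fin.suc i) + f (Fin.suc j) ≤ c
  bound′ i≢j = bound (i≢j ∘ Fin.suc-injective)
  rearrange : 2 * f₀ + (m * c + (f₁ + fₗ)) ≡ (f₀ + f₁) + m * c + (f₀ + fₗ)
  rearrange = solve 4 (λ a b l mc → con 2 :* a :+ (mc :+ (b :+ l)) := (a :+ b) :+ mc :+ (a :+ l))
                      refl f₀ f₁ fₗ (m * c)
    where open +-*-Solver

2*sumℕ≤k*c : ∀ {k} → 2 ≤ k → (f : Fin k → ℕ) {c : ℕ} → (∀ {i j} → i ≢ j → f i + f j ≤ c) →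
             2 * sumℕ f ≤ k * c
2*sumℕ≤k*c {1}                 (ℕ.s≤s ()) _ _
2*sumℕ≤k*c {suc (suc m)} _ f {c} bound = begin
  2 * sumℕ f                                        ≤⟨ 2*sumℕ≤ f bound ⟩
  suc m * c + (f Fin.zero + f (Fin.fromℕ (suc m))) ≤⟨ ℕ.+-monoʳ-≤ (suc m * c) (bound λ ()) ⟩
  suc m * c + c                                   ≡⟨ ℕ.+-comm (suc m * c) c ⟩
  suc (suc m) * c                               ∎
  where open ℕ.≤-Reasoning

∣p∪q∣≤∣p∣+∣q∣ : ∀ {n} (p q : Subset n) → ∣ p ∪ q ∣ ≤ ∣ p ∣ + ∣ q ∣
∣p∪q∣≤∣p∣+∣q∣ []            []            = ℕ.z≤n
∣p∪q∣≤∣p∣+∣q∣ (inside ∷ p)  (y ∷ q)       =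
  ℕ.s≤s (ℕ.≤-trans (∣p∪q∣≤∣p∣+∣q∣ p q) (ℕ.+-monoʳ-≤ ∣ p ∣ (∣p∣≤∣x∷p∣ y q)))
∣p∪q∣≤∣p∣+∣q∣ (outside ∷ p) (inside ∷ q)  =
  ℕ.≤-trans (ℕ.s≤s (∣p∪q∣≤∣p∣+∣q∣ p q)) (ℕ.≤-reflexive (≡.sym (ℕ.+-suc ∣ p ∣ ∣ q ∣)))
∣p∪q∣≤∣p∣+∣q∣ (outside ∷ p) (outside ∷ q) = ∣p∪q∣≤∣p∣+∣q∣ p q

∣p∩q∣+∣p─q∣≡∣p∣ : ∀ {n} (p q : Subset n) → ∣ p ∩ q ∣ + ∣ p ─ q ∣ ≡ ∣ p ∣
∣p∩q∣+∣p─q∣≡∣p∣ []            []            = refl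
∣p∩q∣+∣p─q∣≡∣p∣ (inside ∷ p)  (inside ∷ q)  = cong suc (∣p∩q∣+∣p─q∣≡∣p∣ p q)
∣p∩q∣+∣p─q∣≡∣p∣ (inside ∷ p)  (outside ∷ q) =
  ≡.trans (ℕ.+-suc ∣ p ∩ q ∣ ∣ p ─ q ∣) (cong suc (∣p∩q∣+∣p─q∣≡∣p∣ p q))
∣p∩q∣+∣p─q∣≡∣p∣ (outside ∷ p) (inside ∷ q)  = ∣p∩q∣+∣p─q∣≡∣p∣ p q
∣p∩q∣+∣p─q∣≡∣p∣ (outside ∷ p) (outside ∷ q) = ∣p∩q∣+∣p─q∣≡∣p∣ p q

p∩q∪p─q≡p : ∀ {n} (p q : Subset n) → (p ∩ q) ∪ (p ─ q) ≡ p
p∩q∪p─q≡p []      []            = refl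
p∩q∪p─q≡p (x ∷ p) (inside ∷ q)  =
  cong₂ _∷_ (≡.trans (Bool.∨-identityʳ (x ∧ true)) (Bool.∧-identityʳ x)) (p∩q∪p─q≡p p q)
p∩q∪p─q≡p (x ∷ p) (outside ∷ q) = cong₂ _∷_ (cong (_∨ x) (Bool.∧-zeroʳ x)) (p∩q∪p─q≡p p q)

below : ∀ {n} → ℕ → Subset n
below {zero}  _           = []
below {suc n} zero      = outside ∷ below zero
below {suc n} (suc j)   = inside ∷ below j

below-0≡⊥ : ∀ {n} → below {n} 0 ≡ ⊥
below-0≡⊥ {zero}  = refl
below-0≡⊥ {suc n} = cong (outside ∷_) below-0≡⊥

below-n≡⊤ : ∀ n → below {n} n ≡ ⊤
below-n≡⊤ zero    = refl
below-n≡⊤ (suc n) = cong (inside ∷_) (below-n≡⊤ n)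

∣p∩below[1+j]∣≤1+∣p∩below[j]∣ : ∀ {n} (p : Subset n) j →
                                ∣ p ∩ below (suc j) ∣ ≤ suc ∣ p ∩ below j ∣
∣p∩below[1+j]∣≤1+∣p∩below[j]∣ []            _         = ℕ.z≤n
∣p∩below[1+j]∣≤1+∣p∩below[j]∣ (inside ∷ p)  zero    = ℕ.≤-refl
∣p∩below[1+j]∣≤1+∣p∩below[j]∣ (outside ∷ p) zero    = ℕ.n≤1+n _
∣p∩below[1+j]∣≤1+∣p∩below[j]∣ (inside ∷ p)  (suc j) = ℕ.s≤s (∣p∩below[1+j]∣≤1+∣p∩below[j]∣ p j)
∣p∩below[1+j]∣≤1+∣p∩below[j]∣ (outside ∷ p) (suc j) = ∣p∩below[1+j]∣≤1+∣p∩below[j]∣ p j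

initial-or-crossing : ∀ {p} {P : ℕ → Set p} → Decidable P →
                      ∀ {m} → P m → P 0 ⊎ ∃[ j ] (¬ P j × P (suc j))
initial-or-crossing P? {zero}  P0   = inj₁ P0
initial-or-crossing P? {suc m} P1+m with P? m
... | yes Pm  = initial-or-crossing P? Pm
... | no  ¬Pm = inj₂ (m , ¬Pm , P1+m)

lookup-ext : ∀ {a} {A : Set a} {n} {xs ys : Vec A n} → (∀ i → lookup xs i ≡ lookup ys i) → xs ≡ ys
lookup-ext {xs = xs} {ys} eq =
  ≡.trans (≡.sym (Vec.tabulate∘lookup xs)) (≡.trans (Vec.tabulate-cong eq) (Vec.tabulate∘lookup ys))

∨-interchange : ∀ a b c d → (a ∨ b) ∨ (c ∨ d) ≡ (a ∨ c) ∨ (b ∨ d)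
∨-interchange = interchange (CommutativeMonoid.commutativeSemigroup Bool.∨-commutativeMonoid)

anyFin-cong : ∀ {n} {f g : Fin n → Bool} → (∀ i → f i ≡ g i) → anyFin f ≡ anyFin g
anyFin-cong {zero}  eq = refl
anyFin-cong {suc n} eq = cong₂ _∨_ (eq Fin.zero) (anyFin-cong (eq ∘ Fin.suc))

anyFin-∨ : ∀ {n} (f g : Fin n → Bool) → anyFin (λ i → f i ∨ g i) ≡ anyFin f ∨ anyFin g
anyFin-∨ {zero}  f g = refl
anyFin-∨ {suc n} f g =
  ≡.trans (cong ((f Fin.zero ∨ g Fin.zero) ∨_) (anyFin-∨ (f ∘ Fin.suc) (g ∘ Fin.suc)))
          (∨-interchange (f Fin.zero) (g Fin.zero) (anyFin (f ∘ Fin.suc)) (anyFin (g ∘ Fin.suc)))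

module _ {n} (G : Graph n) where

  closedNbhd-∪ : ∀ S T → closedNbhd G (S ∪ T) ≡ closedNbhd G S ∪ closedNbhd G T
  closedNbhd-∪ S T = lookup-ext λ v → begin
    lookup (closedNbhd G (S ∪ T)) v
      ≡⟨ Vec.lookup∘tabulate _ v ⟩
    lookup (S ∪ T) v ∨ anyFin (λ u → lookup (S ∪ T) u ∧ adj G u v)
      ≡⟨ cong₂ _∨_ (∪-lookup v) (anyFin-cong λ u →
           ≡.trans (cong (_∧ adj G u v) (∪-lookup u)) (Bool.∧-distribʳ-∨ (adj G u v) (s u) (t u))) ⟩
    (s v ∨ t v) ∨ anyFin (λ u → (s u ∧ adj G u v) ∨ (t u ∧ adj G u v))
      ≡⟨ cong ((s v ∨ t v) ∨_) (anyFin-∨ (λ u → s u ∧ adj G u v) (λ u → t u ∧ adj G u v)) ⟩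
    (s v ∨ t v) ∨ (anyFin (λ u → s u ∧ adj G u v) ∨ anyFin (λ u → t u ∧ adj G u v))
      ≡⟨ ∨-interchange (s v) (t v) _ _ ⟩
    (s v ∨ anyFin (λ u → s u ∧ adj G u v)) ∨ (t v ∨ anyFin (λ u → t u ∧ adj G u v))
      ≡⟨ cong₂ _∨_ (Vec.lookup∘tabulate _ v) (Vec.lookup∘tabulate _ v) ⟨
    lookup (closedNbhd G S) v ∨ lookup (closedNbhd G T) v
      ≡⟨ Vec.lookup-zipWith _∨_ v (closedNbhd G S) (closedNbhd G T) ⟨
    lookup (closedNbhd G S ∪ closedNbhd G T) v
      ∎
    where
    open ≡-Reasoning
    s t : Fin n → Bool
    s = lookup S
    t = lookup T
    ∪-lookup : ∀ u → lookup (S ∪ T) u ≡ s u ∨ t u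
    ∪-lookup u = Vec.lookup-zipWith _∨_ u S T

  dom⇒split-covers : ∀ D P → IsDom G D →
                     n ≤ ∣ closedNbhd G (D ∩ P) ∣ + ∣ closedNbhd G (D ─ P) ∣
  dom⇒split-covers D P dom = begin
    n                                ≡⟨ dom ⟨
    ∣ closedNbhd G D ∣               ≡⟨ cong (∣_∣ ∘ closedNbhd G) (p∩q∪p─q≡p D P) ⟨
    ∣ closedNbhd G (D ∩ P ∪ (D ─ P)) ∣ ≡⟨ cong ∣_∣ (closedNbhd-∪ (D ∩ P) (D ─ P)) ⟩
    ∣ N[D∩P] ∪ N[D─P] ∣              ≤⟨ ∣p∪q∣≤∣p∣+∣q∣ N[D∩P] N[D─P] ⟩
    ∣ N[D∩P] ∣ + ∣ N[D─P] ∣          ∎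
    where
    open ℕ.≤-Reasoning
    N[D∩P] N[D─P] : Subset n
    N[D∩P] = closedNbhd G (D ∩ P)
    N[D─P] = closedNbhd G (D ─ P)

  dom⇒partialDom : ∀ D {α} → IsDom G D → α ≤ℚ 1ℚ → IsPartialDom G α D
  dom⇒partialDom D {α} dom α≤1 = subst (λ m → α ℚ.* toℚ n ≤ℚ toℚ m) (≡.sym dom) (*toℚ≤toℚ n α≤1)

  complement-partialDom : ∀ α β S T → α ℚ.+ β ≤ℚ 1ℚ →
                          n ≤ ∣ closedNbhd G S ∣ + ∣ closedNbhd G T ∣ →
                          ¬ IsPartialDom G α S → IsPartialDom G β T
  complement-partialDom α β S T α+β≤1 covers ¬αS =
    x+y≤u+v⇒u<x⇒y≤v shares≤cover (ℚ.≰⇒> ¬αS)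
    where
    open ℚ.≤-Reasoning
    a = ∣ closedNbhd G S ∣
    b = ∣ closedNbhd G T ∣
    shares≤cover : α ℚ.* toℚ n ℚ.+ β ℚ.* toℚ n ≤ℚ toℚ a ℚ.+ toℚ b
    shares≤cover = begin
      α ℚ.* toℚ n ℚ.+ β ℚ.* toℚ n   ≡⟨ ℚ.*-distribʳ-+ (toℚ n) α β ⟨
      (α ℚ.+ β) ℚ.* toℚ n           ≤⟨ *toℚ≤toℚ n α+β≤1 ⟩
      toℚ n                         ≤⟨ toℚ-mono-≤ covers ⟩
      toℚ (a + b)                   ≡⟨ toℚ-+ a b ⟩
      toℚ a ℚ.+ toℚ b               ∎

  dom⇒partialDom-pair : ∀ D {α β} → IsDom G D → 0ℚ ≤ℚ α → 0ℚ ≤ℚ β → α ℚ.+ β ≤ℚ 1ℚ →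
    ∃[ S ] ∃[ T ] (IsPartialDom G α S × IsPartialDom G β T × ∣ S ∣ + ∣ T ∣ ≤ suc (∣ D ∣))
  dom⇒partialDom-pair D {α} {β} dom α≥0 β≥0 α+β≤1 =
    [ initial , crossing ]′ (initial-or-crossing (λ j → _ ℚ.≤? _) α-Aₙ)
    where
    A B : ℕ → Subset n
    A j = D ∩ below j
    B j = D ─ below j

    Pair : Set
    Pair = ∃[ S ] ∃[ T ] (IsPartialDom G α S × IsPartialDom G β T × ∣ S ∣ + ∣ T ∣ ≤ suc (∣ D ∣))

    α≤1 : α ≤ℚ 1ℚ
    α≤1 = ℚ.≤-trans (x≤x+y β≥0) α+β≤1

    β≤1 : β ≤ℚ 1ℚ
    β≤1 = ℚ.≤-trans (x≤y⇒x≤z+y α≥0 ℚ.≤-refl) α+β≤1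

    α-Aₙ : IsPartialDom G α (A n)
    α-Aₙ = subst (IsPartialDom G α) (≡.sym (≡.trans (cong (D ∩_) (below-n≡⊤ n)) (∩-identityʳ D)))
                 (dom⇒partialDom D dom α≤1)

    β-B₀ : IsPartialDom G β (B 0)
    β-B₀ = subst (IsPartialDom G β) (≡.sym (≡.trans (cong (D ─_) below-0≡⊥) (p─⊥≡p D)))
                 (dom⇒partialDom D dom β≤1)

    initial : IsPartialDom G α (A 0) → Pair
    initial α-A₀ =
      A 0 , B 0 , α-A₀ , β-B₀ , ℕ.m≤n⇒m≤1+n (ℕ.≤-reflexive (∣p∩q∣+∣p─q∣≡∣p∣ D (below 0)))

    crossing : ∃[ j ] (¬ IsPartialDom G α (A j) × IsPartialDom G α (A (suc j))) → Pair
    crossing (j , ¬α-Aⱼ , α-Aⱼ₊₁) =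
      A (suc j) , B j , α-Aⱼ₊₁ ,
      complement-partialDom α β (A j) (B j) α+β≤1 (dom⇒split-covers D (below j) dom) ¬α-Aⱼ ,
      ℕ.≤-trans (ℕ.+-monoˡ-≤ ∣ B j ∣ (∣p∩below[1+j]∣≤1+∣p∩below[j]∣ D j))
                (ℕ.≤-reflexive (cong suc (∣p∩q∣+∣p─q∣≡∣p∣ D (below j))))

pd+pd≤γ+1 : ∀ {n} (G : Graph n) {γ α β p q} → IsDomNum G γ →
            0ℚ ≤ℚ α → 0ℚ ≤ℚ β → α ℚ.+ β ≤ℚ 1ℚ → IsPd G α p → IsPd G β q → p + q ≤ γ + 1
pd+pd≤γ+1 G {γ} {p = p} {q} ((D , dom , ∣D∣≡γ) , _) α≥0 β≥0 α+β≤1 (_ , p-min) (_ , q-min)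
  with dom⇒partialDom-pair G D dom α≥0 β≥0 α+β≤1
... | S , T , αS , βT , ∣S∣+∣T∣≤1+∣D∣ = begin
  p + q           ≤⟨ ℕ.+-mono-≤ (p-min S αS) (q-min T βT) ⟩
  ∣ S ∣ + ∣ T ∣   ≤⟨ ∣S∣+∣T∣≤1+∣D∣ ⟩
  suc ∣ D ∣     ≡⟨ cong suc ∣D∣≡γ ⟩
  suc γ         ≡⟨ ℕ.+-comm 1 γ ⟩
  γ + 1           ∎
  where open ℕ.≤-Reasoning

mainTheorem9 : (n : ℕ) (G : Graph n) (γ : ℕ) → IsDomNum G γ →
    (k : ℕ) → 2 ≤ k →
    (α : Fin k → ℚ) → (∀ i → 0ℚ < α i) → (∀ i → α i < 1ℚ) →
    sumℚ α ≤ℚ 1ℚ →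
    (p : Fin k → ℕ) → (∀ i → IsPd G (α i) (p i)) →
    2 * sumℕ p ≤ k * (γ + 1)
mainTheorem9 n G γ γ-dom k 2≤k α α>0 _ Σα≤1 p p-pd = 2*sumℕ≤k*c 2≤k p λ {i} {j} i≢j →
  pd+pd≤γ+1 G γ-dom (α≥0 i) (α≥0 j) (ℚ.≤-trans (two-terms≤sumℚ α α≥0 i≢j) Σα≤1) (p-pd i) (p-pd j)
  where
  α≥0 : ∀ i → 0ℚ ≤ℚ α i
  α≥0 i = ℚ.<⇒≤ (α>0 i)
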